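{- Let $K$ be a global function field and let $1\le r\le n$ be integers. Then for any $1\le m\le n$, $$\sum_{\deg P\le m}\Psi(n-r\deg P,\deg P)\le\frac{n}{r}\,\Psi(n,m),$$ the sum running over prime divisors $P$ of $K$ with $\deg P\le m$.
   Context: $K$ is a finite extension of $\mathbb{F}_p(x)$ with constant field $\mathbb{F}_q$; prime divisors are places of $K$ with $\deg P$ defined by $|P|=q^{\deg P}$. Effective divisors are finite formal sums $\sum a_PP$, $a_P\ge0$, of degree $\sum a_P\deg P$. For effective $D$, $d^+(D)=\max\{\deg P: P\mid D\}$ (and $d^+(0)=0$). For integers $n,m$, $\Psi(n,m)=\#\{D\text{ effective}:\deg D=n,\ d^+(D)\le m\}$ (which is $0$ if $n<0$). -}

module Defs where

open import Data.Nat using (ℕ; zero; suc; _+_; _*_; _∸_; _≤ᵇ_; _≡ᵇ_)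
open import Data.Bool using (if_then_else_)
open import Data.List using (List; []; _∷_; _++_; replicate; map; upTo)
open import Data.Nat.ListAction using (sum)

-- Abstract model of the prime divisors of a global function field K:
-- N k = number of prime divisors P of K with deg P = k (k ≥ 1);
-- N 0 is ignored (there are no primes of degree 0).
PrimeCounts : Set
PrimeCounts = ℕ → ℕ

-- The list of prime divisors P with deg P ≤ m, each recorded by its degree
-- (a prime of degree k appears once for each of the N k primes of degree k).
primesUpTo : PrimeCounts → ℕ → List ℕ
primesUpTo N zero    = []
primesUpTo N (suc m) = primesUpTo N m ++ replicate (N (suc m)) (suc m)

-- Number of effective divisors supported on the listed primes having degree n,
-- i.e. number of multiplicity assignments (a_P ≥ 0) with Σ a_P deg P = n.
-- (All listed degrees are ≥ 1, so a_P ≤ n.)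
countDiv : List ℕ → ℕ → ℕ
countDiv []       n = if n ≡ᵇ 0 then 1 else 0
countDiv (d ∷ ds) n =
  sum (map (λ a → if a * d ≤ᵇ n then countDiv ds (n ∸ a * d) else 0) (upTo (suc n)))

Ψ : PrimeCounts → ℕ → ℕ → ℕ
Ψ N n m = countDiv (primesUpTo N m) n

-- Ψ(n - r k, k), which is 0 when n - r k < 0.
Ψshift : PrimeCounts → ℕ → ℕ → ℕ → ℕ
Ψshift N n r k = if r * k ≤ᵇ n then Ψ N (n ∸ r * k) k else 0

primeSum : PrimeCounts → ℕ → ℕ → ℕ → ℕ
primeSum N n r m = sum (map (λ k → Ψshift N n r k) (primesUpTo N m))

-- Write Ψ_L(n) for the number of effective divisors of degree n supported on a
-- list L of primes. Adjoining a prime P of degree d gives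
-- Ψ_{P∷L}(n) = Σ_a Ψ_L(n − a d), the sum over the multiplicity a of P.
-- The claim, r Σ_{Q ∈ L} Ψ_L(n − r deg Q) ≤ n Ψ_L(n), is proved by induction on L.
-- For L = P ∷ L', the terms Q ∈ L' are handled by the induction hypothesis inside
-- each summand, which bounds them by Σ_a (n − a d) Ψ_{L'}(n − a d); the term Q = P
-- is bounded by Σ_a a d Ψ_{L'}(n − a d), since r ≤ (a + r) d. The two bounds add
-- up to n Ψ_{P∷L'}(n). Finally Ψ_L(k) only grows when primes are added to L,
-- which replaces the primes of degree ≤ deg P in the theorem by those of degree ≤ m.
module Submission where

open import Defs
open import Data.Bool using (true; false; if_then_else_)
open import Data.List using (List; []; _∷_; _++_; [_]; map; upTo)
open import Data.List.Properties using (map-cong; map-++; upTo-∷ʳ)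
open import Data.List.Relation.Unary.All as All using (All; []; _∷_)
open import Data.List.Relation.Unary.All.Properties using (++⁺; replicate⁺)
open import Data.Nat
  using (ℕ; zero; suc; _+_; _*_; _∸_; _≤_; _<_; _≤′_; ≤′-refl; ≤′-step; _≤ᵇ_; _≤?_; z≤n; s≤s; >-nonZero)
open import Data.Nat.ListAction using (sum)
open import Data.Nat.ListAction.Properties using (sum-++)
open import Data.Nat.Properties
open import Algebra.Properties.CommutativeSemigroup +-commutativeSemigroup using (interchange)
open import Data.Product using (_×_; _,_; proj₁)
open import Function using (_∘_)
open import Relation.Binary.PropositionalEquality using (_≡_; refl; sym; trans; cong; cong₂; subst; module ≡-Reasoning)
open import Relation.Nullary.Decidable using (yes; no)
open import Relation.Nullary.Negation using (¬_; contradiction)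
open import Relation.Nullary.Reflects using (ofʸ; ofⁿ)

private
  variable
    A : Set

sum-map-zero : ∀ {f : A → ℕ} → (∀ x → f x ≡ 0) → ∀ xs → sum (map f xs) ≡ 0
sum-map-zero f≡0 []       = refl
sum-map-zero f≡0 (x ∷ xs) = cong₂ _+_ (f≡0 x) (sum-map-zero f≡0 xs)

sum-map-mono : ∀ {f g : A → ℕ} {xs} → All (λ x → f x ≤ g x) xs →
               sum (map f xs) ≤ sum (map g xs)
sum-map-mono []           = z≤n
sum-map-mono (fx≤gx ∷ ps) = +-mono-≤ fx≤gx (sum-map-mono ps)

sum-map-+ : ∀ (f g : A → ℕ) xs →
            sum (map (λ x → f x + g x) xs) ≡ sum (map f xs) + sum (map g xs)
sum-map-+ f g []       = refl
sum-map-+ f g (x ∷ xs) = begin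
  (f x + g x) + sum (map (λ x → f x + g x) xs)  ≡⟨ cong ((f x + g x) +_) (sum-map-+ f g xs) ⟩
  (f x + g x) + (sum (map f xs) + sum (map g xs)) ≡⟨ interchange (f x) (g x) _ _ ⟩
  (f x + sum (map f xs)) + (g x + sum (map g xs)) ∎
  where open ≡-Reasoning

*-distribˡ-sum-map : ∀ c (f : A → ℕ) xs → c * sum (map f xs) ≡ sum (map (λ x → c * f x) xs)
*-distribˡ-sum-map c f []       = *-zeroʳ c
*-distribˡ-sum-map c f (x ∷ xs) =
  trans (*-distribˡ-+ c (f x) _) (cong (c * f x +_) (*-distribˡ-sum-map c f xs))

sum-map-swap : ∀ {B : Set} (F : A → B → ℕ) xs ys →
               sum (map (λ x → sum (map (F x) ys)) xs) ≡ sum (map (λ y → sum (map (λ x → F x y) xs)) ys)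
sum-map-swap F []       ys = sym (sum-map-zero (λ _ → refl) ys)
sum-map-swap F (x ∷ xs) ys = begin
  sum (map (F x) ys) + sum (map (λ x → sum (map (F x) ys)) xs)
    ≡⟨ cong (sum (map (F x) ys) +_) (sum-map-swap F xs ys) ⟩
  sum (map (F x) ys) + sum (map (λ y → sum (map (λ x → F x y) xs)) ys)
    ≡⟨ sym (sum-map-+ (F x) _ ys) ⟩
  sum (map (λ y → F x y + sum (map (λ x → F x y) xs)) ys) ∎
  where open ≡-Reasoning

∑< : ℕ → (ℕ → ℕ) → ℕ
∑< K f = sum (map f (upTo K))

∑<-suc : ∀ f K → ∑< (suc K) f ≡ ∑< K f + f K
∑<-suc f K = begin
  sum (map f (upTo (suc K)))          ≡⟨ cong (sum ∘ map f) (sym (upTo-∷ʳ K)) ⟩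
  sum (map f (upTo K ++ [ K ]))       ≡⟨ cong sum (map-++ f (upTo K) [ K ]) ⟩
  sum (map f (upTo K) ++ [ f K ])     ≡⟨ sum-++ (map f (upTo K)) [ f K ] ⟩
  ∑< K f + (f K + 0)                  ≡⟨ cong (∑< K f +_) (+-identityʳ (f K)) ⟩
  ∑< K f + f K                        ∎
  where open ≡-Reasoning

∑<-extend : ∀ {K K'} f → K ≤ K' → (∀ a → K ≤ a → f a ≡ 0) → ∑< K' f ≡ ∑< K f
∑<-extend {K} f K≤K' vanish = extend (≤⇒≤′ K≤K')
  where
  open ≡-Reasoning
  extend : ∀ {K'} → K ≤′ K' → ∑< K' f ≡ ∑< K f
  extend ≤′-refl = refl
  extend {suc K'} (≤′-step K≤′K') = begin
    ∑< (suc K') f   ≡⟨ ∑<-suc f K' ⟩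
    ∑< K' f + f K'  ≡⟨ cong (∑< K' f +_) (vanish K' (≤′⇒≤ K≤′K')) ⟩
    ∑< K' f + 0     ≡⟨ +-identityʳ _ ⟩
    ∑< K' f         ≡⟨ extend K≤′K' ⟩
    ∑< K f          ∎

∑<-shift : ∀ f r K → ∑< K (λ a → f (a + r)) ≤ ∑< (K + r) f
∑<-shift f r zero    = z≤n
∑<-shift f r (suc K) = begin
  ∑< (suc K) (λ a → f (a + r))        ≡⟨ ∑<-suc _ K ⟩
  ∑< K (λ a → f (a + r)) + f (K + r)  ≤⟨ +-monoˡ-≤ (f (K + r)) (∑<-shift f r K) ⟩
  ∑< (K + r) f + f (K + r)            ≡⟨ sym (∑<-suc f (K + r)) ⟩
  ∑< (suc K + r) f                    ∎
  where open ≤-Reasoning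

-- f evaluated at the integer n − k, with f taken to vanish at negative arguments.
_[_⊖_] : (ℕ → ℕ) → ℕ → ℕ → ℕ
f [ n ⊖ k ] = if k ≤ᵇ n then f (n ∸ k) else 0

⊖-≤ : ∀ f {n k} → k ≤ n → f [ n ⊖ k ] ≡ f (n ∸ k)
⊖-≤ f {n} {k} k≤n with k ≤ᵇ n | ≤ᵇ-reflects-≤ k n
... | true  | _        = refl
... | false | ofⁿ k≰n = contradiction k≤n k≰n

⊖-> : ∀ f {n k} → n < k → f [ n ⊖ k ] ≡ 0
⊖-> f {n} {k} n<k with k ≤ᵇ n | ≤ᵇ-reflects-≤ k n
... | true  | ofʸ k≤n = contradiction k≤n (<⇒≱ n<k)
... | false | _        = refl

⊖-*-vanish : ∀ f {n a d} → 1 ≤ d → n < a → f [ n ⊖ a * d ] ≡ 0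
⊖-*-vanish f {a = a} {d} d≥1 n<a = ⊖-> f (<-≤-trans n<a (m≤m*n a d {{>-nonZero d≥1}}))

⊖-mono : ∀ {f g} → (∀ m → f m ≤ g m) → ∀ n k → f [ n ⊖ k ] ≤ g [ n ⊖ k ]
⊖-mono f≤g n k with k ≤ᵇ n
... | true  = f≤g (n ∸ k)
... | false = z≤n

*-distribˡ-⊖ : ∀ c f n k → c * f [ n ⊖ k ] ≡ (λ m → c * f m) [ n ⊖ k ]
*-distribˡ-⊖ c f n k with k ≤ᵇ n
... | true  = refl
... | false = *-zeroʳ c

sum-map-⊖ : ∀ (F : A → ℕ → ℕ) xs n k →
            sum (map (λ x → F x [ n ⊖ k ]) xs) ≡ (λ m → sum (map (λ x → F x m) xs)) [ n ⊖ k ]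
sum-map-⊖ F xs n k with k ≤ᵇ n
... | true  = refl
... | false = sum-map-zero (λ _ → refl) xs

⊖-∸ : ∀ f {n i} j → i ≤ n → f [ n ∸ i ⊖ j ] ≡ f [ n ⊖ i + j ]
⊖-∸ f {n} {i} j i≤n with j ≤? n ∸ i
... | yes j≤n∸i = begin
  f [ n ∸ i ⊖ j ]  ≡⟨ ⊖-≤ f j≤n∸i ⟩
  f (n ∸ i ∸ j)    ≡⟨ cong f (∸-+-assoc n i j) ⟩
  f (n ∸ (i + j))  ≡⟨ sym (⊖-≤ f (subst (_≤ n) (+-comm j i) (m≤o∸n⇒m+n≤o j i≤n j≤n∸i))) ⟩
  f [ n ⊖ i + j ]  ∎
  where open ≡-Reasoning
... | no j≰n∸i = trans (⊖-> f (≰⇒> j≰n∸i)) (sym (⊖-> f (≰⇒> i+j≰n)))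
  where
  i+j≰n : ¬ (i + j ≤ n)
  i+j≰n i+j≤n = j≰n∸i (m+n≤o⇒m≤o∸n j (subst (_≤ n) (+-comm i j) i+j≤n))

⊖-+ : ∀ f n i j → f [ n ⊖ i + j ] ≡ (λ m → f [ m ⊖ j ]) [ n ⊖ i ]
⊖-+ f n i j with i ≤? n
... | yes i≤n = trans (sym (⊖-∸ f j i≤n)) (sym (⊖-≤ (λ m → f [ m ⊖ j ]) i≤n))
... | no i≰n  = trans (⊖-> f (<-≤-trans (≰⇒> i≰n) (m≤m+n i j))) (sym (⊖-> (λ m → f [ m ⊖ j ]) (≰⇒> i≰n)))

⊖-weight : ∀ f n k → k * f [ n ⊖ k ] + (λ m → m * f m) [ n ⊖ k ] ≡ n * f [ n ⊖ k ]
⊖-weight f n k with k ≤ᵇ n | ≤ᵇ-reflects-≤ k n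
... | true  | ofʸ k≤n = trans (sym (*-distribʳ-+ (f (n ∸ k)) k (n ∸ k)))
                              (cong (_* f (n ∸ k)) (m+[n∸m]≡n k≤n))
... | false | _        = trans (cong (_+ 0) (*-zeroʳ k)) (sym (*-zeroʳ n))

addPrime : ℕ → (ℕ → ℕ) → ℕ → ℕ
addPrime d h n = ∑< (suc n) (λ a → h [ n ⊖ a * d ])

addPrime-∑< : ∀ {d K} h n → 1 ≤ d → suc n ≤ K → addPrime d h n ≡ ∑< K (λ a → h [ n ⊖ a * d ])
addPrime-∑< {d} h n d≥1 n<K = sym (∑<-extend (λ a → h [ n ⊖ a * d ]) n<K (λ a n<a → ⊖-*-vanish h d≥1 n<a))

addPrime-mono : ∀ d {h h'} → (∀ m → h m ≤ h' m) → ∀ n → addPrime d h n ≤ addPrime d h' n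
addPrime-mono d h≤h' n = sum-map-mono (All.universal (λ a → ⊖-mono h≤h' n (a * d)) (upTo (suc n)))

*-distribˡ-addPrime : ∀ c d h n → c * addPrime d h n ≡ addPrime d (λ m → c * h m) n
*-distribˡ-addPrime c d h n = trans (*-distribˡ-sum-map c (λ a → h [ n ⊖ a * d ]) (upTo (suc n)))
  (cong sum (map-cong (λ a → *-distribˡ-⊖ c h n (a * d)) (upTo (suc n))))

sum-map-addPrime : ∀ d (H : A → ℕ → ℕ) xs n →
  sum (map (λ x → addPrime d (H x) n) xs) ≡ addPrime d (λ m → sum (map (λ x → H x m) xs)) n
sum-map-addPrime d H xs n = trans (sum-map-swap _ xs (upTo (suc n)))
  (cong sum (map-cong (λ a → sum-map-⊖ H xs n (a * d)) (upTo (suc n))))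

addPrime-⊖ : ∀ {d} → 1 ≤ d → ∀ h n j → addPrime d h [ n ⊖ j ] ≡ addPrime d (λ m → h [ m ⊖ j ]) n
addPrime-⊖ {d} d≥1 h n j with j ≤? n
... | yes j≤n = begin
  addPrime d h [ n ⊖ j ]                    ≡⟨ ⊖-≤ (addPrime d h) j≤n ⟩
  addPrime d h (n ∸ j)                      ≡⟨ addPrime-∑< h (n ∸ j) d≥1 (s≤s (m∸n≤m n j)) ⟩
  ∑< (suc n) (λ a → h [ n ∸ j ⊖ a * d ])    ≡⟨ cong sum (map-cong shift (upTo (suc n))) ⟩
  addPrime d (λ m → h [ m ⊖ j ]) n          ∎
  where
  open ≡-Reasoning
  shift : ∀ a → h [ n ∸ j ⊖ a * d ] ≡ (λ m → h [ m ⊖ j ]) [ n ⊖ a * d ]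
  shift a = trans (⊖-∸ h (a * d) j≤n)
                  (trans (cong (h [ n ⊖_]) (+-comm j (a * d))) (⊖-+ h n (a * d) j))
... | no j≰n = trans (⊖-> (addPrime d h) (≰⇒> j≰n)) (sym (sum-map-zero vanish (upTo (suc n))))
  where
  vanish : ∀ a → (λ m → h [ m ⊖ j ]) [ n ⊖ a * d ] ≡ 0
  vanish a = trans (sym (⊖-+ h n (a * d) j)) (⊖-> h (<-≤-trans (≰⇒> j≰n) (m≤n+m j (a * d))))

shiftSum : ℕ → List ℕ → (ℕ → ℕ) → ℕ → ℕ
shiftSum r ks h n = sum (map (λ k → r * h [ n ⊖ r * k ]) ks)

shiftSum-addPrime : ∀ {d} → 1 ≤ d → ∀ r ks h n →
                    shiftSum r ks (addPrime d h) n ≡ addPrime d (shiftSum r ks h) n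
shiftSum-addPrime {d} d≥1 r ks h n = trans (cong sum (map-cong term ks))
                                           (sum-map-addPrime d (λ k m → r * h [ m ⊖ r * k ]) ks n)
  where
  term : ∀ k → r * addPrime d h [ n ⊖ r * k ] ≡ addPrime d (λ m → r * h [ m ⊖ r * k ]) n
  term k = trans (cong (r *_) (addPrime-⊖ d≥1 h n (r * k))) (*-distribˡ-addPrime r d (λ m → h [ m ⊖ r * k ]) n)

addPrime-shift-self : ∀ {d} → 1 ≤ d → ∀ r h n →
  r * addPrime d h [ n ⊖ r * d ] ≤ ∑< (suc n) (λ a → a * d * h [ n ⊖ a * d ])
addPrime-shift-self {d} d≥1 r h n = begin
  r * addPrime d h [ n ⊖ r * d ]                ≡⟨ cong (r *_) (addPrime-⊖ d≥1 h n (r * d)) ⟩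
  r * addPrime d (λ m → h [ m ⊖ r * d ]) n      ≡⟨ *-distribˡ-addPrime r d (λ m → h [ m ⊖ r * d ]) n ⟩
  addPrime d (λ m → r * h [ m ⊖ r * d ]) n      ≤⟨ sum-map-mono (All.universal term (upTo (suc n))) ⟩
  ∑< (suc n) (λ a → weighted (a + r))           ≤⟨ ∑<-shift weighted r (suc n) ⟩
  ∑< (suc n + r) weighted                       ≡⟨ ∑<-extend weighted (m≤m+n (suc n) r) vanish ⟩
  ∑< (suc n) weighted                           ∎
  where
  open ≤-Reasoning
  weighted : ℕ → ℕ
  weighted a = a * d * h [ n ⊖ a * d ]
  vanish : ∀ a → suc n ≤ a → weighted a ≡ 0
  vanish a n<a = trans (cong (a * d *_) (⊖-*-vanish h d≥1 n<a)) (*-zeroʳ (a * d))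
  term : ∀ a → (λ m → r * h [ m ⊖ r * d ]) [ n ⊖ a * d ] ≤ weighted (a + r)
  term a = begin
    (λ m → r * h [ m ⊖ r * d ]) [ n ⊖ a * d ]  ≡⟨ sym (*-distribˡ-⊖ r (λ m → h [ m ⊖ r * d ]) n (a * d)) ⟩
    r * (λ m → h [ m ⊖ r * d ]) [ n ⊖ a * d ]  ≡⟨ cong (r *_) (sym (⊖-+ h n (a * d) (r * d))) ⟩
    r * h [ n ⊖ a * d + r * d ]                ≡⟨ cong (λ k → r * h [ n ⊖ k ]) (sym (*-distribʳ-+ d a r)) ⟩
    r * h [ n ⊖ (a + r) * d ]                  ≤⟨ *-monoˡ-≤ _ r≤[a+r]*d ⟩
    weighted (a + r)                           ∎
    where
    r≤[a+r]*d : r ≤ (a + r) * d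
    r≤[a+r]*d = ≤-trans (m≤n+m r a) (m≤m*n (a + r) d {{>-nonZero d≥1}})

-- Each divisor of degree n − a d carries weight a d from the new prime and
-- weight n − a d from the old ones.
addPrime-weight : ∀ d h n →
  ∑< (suc n) (λ a → a * d * h [ n ⊖ a * d ]) + addPrime d (λ m → m * h m) n ≡ n * addPrime d h n
addPrime-weight d h n = begin
  ∑< (suc n) (λ a → a * d * h [ n ⊖ a * d ]) + addPrime d (λ m → m * h m) n
    ≡⟨ sym (sum-map-+ (λ a → a * d * h [ n ⊖ a * d ]) (λ a → (λ m → m * h m) [ n ⊖ a * d ]) (upTo (suc n))) ⟩
  ∑< (suc n) (λ a → a * d * h [ n ⊖ a * d ] + (λ m → m * h m) [ n ⊖ a * d ])
    ≡⟨ cong sum (map-cong (λ a → ⊖-weight h n (a * d)) (upTo (suc n))) ⟩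
  ∑< (suc n) (λ a → n * h [ n ⊖ a * d ])
    ≡⟨ sym (*-distribˡ-sum-map n _ (upTo (suc n))) ⟩
  n * addPrime d h n ∎
  where open ≡-Reasoning

shiftSum-countDiv : ∀ r {ds} → All (1 ≤_) ds → ∀ n → shiftSum r ds (countDiv ds) n ≤ n * countDiv ds n
shiftSum-countDiv r []                      n = z≤n
shiftSum-countDiv r {d ∷ ds} (d≥1 ∷ ds≥1) n = begin
  r * addPrime d C [ n ⊖ r * d ] + shiftSum r ds (addPrime d C) n
    ≤⟨ +-mono-≤ (addPrime-shift-self d≥1 r C n) (≤-reflexive (shiftSum-addPrime d≥1 r ds C n)) ⟩
  ∑< (suc n) (λ a → a * d * C [ n ⊖ a * d ]) + addPrime d (shiftSum r ds C) n
    ≤⟨ +-monoʳ-≤ (∑< (suc n) (λ a → a * d * C [ n ⊖ a * d ])) (addPrime-mono d (shiftSum-countDiv r ds≥1) n) ⟩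
  ∑< (suc n) (λ a → a * d * C [ n ⊖ a * d ]) + addPrime d (λ m → m * C m) n
    ≡⟨ addPrime-weight d C n ⟩
  n * addPrime d C n ∎
  where
  open ≤-Reasoning
  C : ℕ → ℕ
  C = countDiv ds

1≤countDiv-zero : ∀ ds → 1 ≤ countDiv ds 0
1≤countDiv-zero []       = s≤s z≤n
1≤countDiv-zero (d ∷ ds) = ≤-trans (1≤countDiv-zero ds) (m≤m+n _ 0)

countDiv-++ : ∀ ds es n → countDiv ds n ≤ countDiv (ds ++ es) n
countDiv-++ []       es zero    = 1≤countDiv-zero es
countDiv-++ []       es (suc n) = z≤n
countDiv-++ (d ∷ ds) es n       = addPrime-mono d (countDiv-++ ds es) n

countDiv-primesUpTo-mono : ∀ N {k m} → k ≤ m → ∀ n →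
                           countDiv (primesUpTo N k) n ≤ countDiv (primesUpTo N m) n
countDiv-primesUpTo-mono N {k} k≤m n = mono (≤⇒≤′ k≤m)
  where
  mono : ∀ {m} → k ≤′ m → countDiv (primesUpTo N k) n ≤ countDiv (primesUpTo N m) n
  mono ≤′-refl                = ≤-refl
  mono {suc m} (≤′-step k≤′m) = ≤-trans (mono k≤′m) (countDiv-++ (primesUpTo N m) _ n)

primesUpTo-degrees : ∀ N m → All (λ k → 1 ≤ k × k ≤ m) (primesUpTo N m)
primesUpTo-degrees N zero    = []
primesUpTo-degrees N (suc m) =
  ++⁺ (All.map (λ (1≤k , k≤m) → 1≤k , m≤n⇒m≤1+n k≤m) (primesUpTo-degrees N m))
      (replicate⁺ (N (suc m)) (s≤s z≤n , ≤-refl))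

lemma4p2 : (N : PrimeCounts) (n r m : ℕ) →
    1 ≤ r → r ≤ n → 1 ≤ m → m ≤ n →
    r * primeSum N n r m ≤ n * Ψ N n m
lemma4p2 N n r m _ _ _ _ = begin
  r * primeSum N n r m                    ≡⟨ *-distribˡ-sum-map r _ ps ⟩
  sum (map (λ k → r * Ψshift N n r k) ps) ≤⟨ sum-map-mono (All.map enlarge (primesUpTo-degrees N m)) ⟩
  shiftSum r ps (countDiv ps) n           ≤⟨ shiftSum-countDiv r (All.map proj₁ (primesUpTo-degrees N m)) n ⟩
  n * Ψ N n m                             ∎
  where
  open ≤-Reasoning
  ps : List ℕ
  ps = primesUpTo N m
  enlarge : ∀ {k} → 1 ≤ k × k ≤ m → r * Ψshift N n r k ≤ r * countDiv ps [ n ⊖ r * k ]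
  enlarge {k} (_ , k≤m) = *-monoʳ-≤ r (⊖-mono (countDiv-primesUpTo-mono N k≤m) n (r * k))
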